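{- Let $A\subseteq[n]$ with $|A|>\lceil n/2\rceil$. Then $$s(A)\geq (|A|-\lceil n/2\rceil)(|A|-\lfloor n/2\rfloor)-|A|/2.$$ In particular, $s([n])=\frac{n^2-2n}{4}$ if $n$ is even and $s([n])=\frac{n^2-2n+1}{4}$ if $n$ is odd.
   Context: A restricted Schur triple in $[n]=\{1,\dots,n\}$ is an ordered triple $(a,b,c)$ of elements of $[n]$ with $a<b<c$ and $a+b=c$. For $A\subseteq[n]$, $s(A)$ denotes the number of restricted Schur triples with all three entries in $A$. -}

module Defs where

open import Data.Nat using (ℕ; suc; _+_; _<_; _<?_)
open import Data.Nat.Properties using (_≟_)
open import Data.Fin using (Fin; toℕ)
open import Data.Fin.Subset using (Subset; _∈_)
open import Data.Fin.Subset.Properties using (_∈?_)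
open import Data.List using (List; length; filter; allFin; cartesianProduct)
open import Data.Product using (_×_; _,_)
open import Relation.Binary.PropositionalEquality using (_≡_)
open import Relation.Nullary using (Dec; _×-dec_)

-- Convention: [n] = {1,…,n} is encoded by Fin n, where i : Fin n stands
-- for the integer toℕ i + 1.  A subset A ⊆ [n] is a Subset n.

val : ∀ {n} → Fin n → ℕ
val i = suc (toℕ i)

IsSchurTripleIn : ∀ {n} → Subset n → Fin n × Fin n × Fin n → Set
IsSchurTripleIn A (a , b , c) =
  a ∈ A × b ∈ A × c ∈ A × val a < val b × val a + val b ≡ val c

isSchurTripleIn? : ∀ {n} (A : Subset n) (t : Fin n × Fin n × Fin n) → Dec (IsSchurTripleIn A t)
isSchurTripleIn? A (a , b , c) =
  (a ∈? A) ×-dec (b ∈? A) ×-dec (c ∈? A) ×-dec (val a <? val b) ×-dec (val a + val b ≟ val c)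

allTriples : (n : ℕ) → List (Fin n × Fin n × Fin n)
allTriples n = cartesianProduct (allFin n) (cartesianProduct (allFin n) (allFin n))

s : ∀ {n} → Subset n → ℕ
s {n} A = length (filter (isSchurTripleIn? A) (allTriples n))

module Submission where

-- For k ∈ A, the Schur triples with largest entry k correspond to the pairs a < k − a of
-- elements of A. Pairing the integers below k in this way, if A has c elements below k then at
-- least c − ⌈(k − 1)/2⌉ of these pairs lie in A. Scanning [n] from left to right, the excess
-- 2c − N of A over half of [N] grows by at most one per step, and when it grows from e the new
-- element closes at least ⌊e/2⌋ triples. Hence s(A) ≥ Σ_{j < e} ⌊j/2⌋ = ⌊e/2⌋⌈e/2⌉ − ⌊e/2⌋
-- for e = 2|A| − n, which is the bound since ⌊e/2⌋ = |A| − ⌈n/2⌉ and ⌈e/2⌉ = |A| − ⌊n/2⌋.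
-- For A = [n] every pair is present and s([n]) = Σ_{k < n} ⌊k/2⌋ exactly.

open import Defs

module FiniteSums where

  open import Data.Bool using (Bool; true; false)
  open import Data.Fin using (Fin; zero; suc; toℕ)
  open import Data.List using ([]; _∷_; _++_; length; filter; map; tabulate; allFin; cartesianProduct)
  open import Data.List.Properties using (map-++; map-∘; map-tabulate)
  open import Data.Nat
  open import Data.Nat.ListAction using (sum)
  open import Data.Nat.ListAction.Properties using (sum-++)
  open import Data.Nat.Properties
  open import Data.Nat.Tactic.RingSolver using (solve-∀)
  open import Data.Product using (_×_; _,_)
  open import Function using (_∘_; id)
  open import Relation.Binary.PropositionalEquality
  open import Relation.Nullary using (does; yes; no)
  open import Relation.Unary using (Decidable)

  𝟙 : Bool → ℕ
  𝟙 true  = 1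
  𝟙 false = 0

  𝟙≤1 : ∀ b → 𝟙 b ≤ 1
  𝟙≤1 true  = ≤-refl
  𝟙≤1 false = z≤n

  ∑< : ℕ → (ℕ → ℕ) → ℕ
  ∑< zero    f = 0
  ∑< (suc n) f = ∑< n f + f n

  syntax ∑< n (λ i → e) = ∑[ i < n ] e

  ∑-cong : ∀ n {f g} → (∀ i → i < n → f i ≡ g i) → ∑< n f ≡ ∑< n g
  ∑-cong zero    f≗g = refl
  ∑-cong (suc n) f≗g = cong₂ _+_ (∑-cong n λ i i<n → f≗g i (m<n⇒m<1+n i<n)) (f≗g n ≤-refl)

  ∑-zero : ∀ n {f} → (∀ i → i < n → f i ≡ 0) → ∑< n f ≡ 0
  ∑-zero zero    f≗0 = refl
  ∑-zero (suc n) f≗0 = cong₂ _+_ (∑-zero n λ i i<n → f≗0 i (m<n⇒m<1+n i<n)) (f≗0 n ≤-refl)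

  ∑-head : ∀ n f → ∑< (suc n) f ≡ f 0 + ∑< n (f ∘ suc)
  ∑-head zero    f = sym (+-identityʳ (f 0))
  ∑-head (suc n) f = trans (cong (_+ f (suc n)) (∑-head n f)) (+-assoc (f 0) _ _)

  ∑-split : ∀ k d f → ∑< (k + d) f ≡ ∑< k f + ∑[ i < d ] f (k + i)
  ∑-split k zero    f = trans (cong (λ m → ∑< m f) (+-identityʳ k)) (sym (+-identityʳ _))
  ∑-split k (suc d) f = begin
    ∑< (k + suc d) f                                ≡⟨ cong (λ m → ∑< m f) (+-suc k d) ⟩
    ∑< (k + d) f + f (k + d)                         ≡⟨ cong (_+ f (k + d)) (∑-split k d f) ⟩
    ∑< k f + ∑[ i < d ] f (k + i) + f (k + d)         ≡⟨ +-assoc (∑< k f) _ _ ⟩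
    ∑< k f + ∑[ i < suc d ] f (k + i)                ∎
    where open ≡-Reasoning

  ∑-+ : ∀ n f g → ∑[ i < n ] (f i + g i) ≡ ∑< n f + ∑< n g
  ∑-+ zero    f g = refl
  ∑-+ (suc n) f g = trans (cong (_+ (f n + g n)) (∑-+ n f g)) (interchange (∑< n f) (∑< n g) (f n) (g n))
    where
    interchange : ∀ a b c d → (a + b) + (c + d) ≡ (a + c) + (b + d)
    interchange = solve-∀

  ∑-*ˡ : ∀ n c f → ∑[ i < n ] (c * f i) ≡ c * ∑< n f
  ∑-*ˡ zero    c f = sym (*-zeroʳ c)
  ∑-*ˡ (suc n) c f = trans (cong (_+ c * f n) (∑-*ˡ n c f)) (sym (*-distribˡ-+ c (∑< n f) (f n)))

  ∑-swap : ∀ m n (f : ℕ → ℕ → ℕ) → ∑[ i < m ] ∑[ j < n ] f i j ≡ ∑[ j < n ] ∑[ i < m ] f i j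
  ∑-swap zero    n f = sym (∑-zero n λ _ _ → refl)
  ∑-swap (suc m) n f = trans (cong (_+ ∑[ j < n ] f m j) (∑-swap m n f))
                             (sym (∑-+ n (λ j → ∑[ i < m ] f i j) (f m)))

  ∑-single : ∀ n t {f} → t < n → (∀ i → i < n → i ≢ t → f i ≡ 0) → ∑< n f ≡ f t
  ∑-single (suc n) t {f} t<1+n f≗0 with t ≟ n
  ... | yes refl = cong (_+ f n) (∑-zero n λ i i<n → f≗0 i (m<n⇒m<1+n i<n) (<⇒≢ i<n))
  ... | no  t≢n  = begin
    ∑< n f + f n ≡⟨ cong₂ _+_ (∑-single n t (≤∧≢⇒< (s≤s⁻¹ t<1+n) t≢n) λ i i<n → f≗0 i (m<n⇒m<1+n i<n))
                              (f≗0 n ≤-refl (t≢n ∘ sym)) ⟩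
    f t + 0      ≡⟨ +-identityʳ (f t) ⟩
    f t          ∎
    where open ≡-Reasoning

  sum-tabulate : ∀ {n} (f : Fin n → ℕ) g → (∀ i → f i ≡ g (toℕ i)) → sum (tabulate f) ≡ ∑< n g
  sum-tabulate {zero}  f g f≗g = refl
  sum-tabulate {suc n} f g f≗g =
    trans (cong₂ _+_ (f≗g zero) (sum-tabulate (f ∘ suc) (g ∘ suc) (f≗g ∘ suc))) (sym (∑-head n g))

  sum-allFin : ∀ {n} (f : Fin n → ℕ) g → (∀ i → f i ≡ g (toℕ i)) → sum (map f (allFin n)) ≡ ∑< n g
  sum-allFin f g f≗g = trans (cong sum (map-tabulate id f)) (sum-tabulate f g f≗g)

  sum-cartesianProduct : ∀ {a b} {A : Set a} {B : Set b} (f : A × B → ℕ) xs ys →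
    sum (map f (cartesianProduct xs ys)) ≡ sum (map (λ x → sum (map (λ y → f (x , y)) ys)) xs)
  sum-cartesianProduct f []       ys = refl
  sum-cartesianProduct f (x ∷ xs) ys = begin
    sum (map f (map (x ,_) ys ++ cartesianProduct xs ys))
      ≡⟨ cong sum (map-++ f (map (x ,_) ys) _) ⟩
    sum (map f (map (x ,_) ys) ++ map f (cartesianProduct xs ys))
      ≡⟨ sum-++ (map f (map (x ,_) ys)) _ ⟩
    sum (map f (map (x ,_) ys)) + sum (map f (cartesianProduct xs ys))
      ≡⟨ cong₂ _+_ (cong sum (sym (map-∘ ys))) (sum-cartesianProduct f xs ys) ⟩
    sum (map (λ y → f (x , y)) ys) + sum (map (λ x → sum (map (λ y → f (x , y)) ys)) xs) ∎
    where open ≡-Reasoning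

  length-filter : ∀ {a p} {A : Set a} {P : A → Set p} (P? : Decidable P) xs →
    length (filter P? xs) ≡ sum (map (𝟙 ∘ does ∘ P?) xs)
  length-filter P? []       = refl
  length-filter P? (x ∷ xs) with does (P? x)
  ... | true  = cong suc (length-filter P? xs)
  ... | false = length-filter P? xs

module HalfSums where

  open import Data.Nat
  open import Data.Nat.Properties
  open import Data.Nat.Tactic.RingSolver using (solve-∀)
  open import Data.Product using (_,_)
  open import Relation.Binary.PropositionalEquality
  open FiniteSums

  sumHalves : ℕ → ℕ
  sumHalves n = ∑[ k < n ] ⌊ k /2⌋

  sumHalves-mono-≤ : ∀ {m n} → m ≤ n → sumHalves m ≤ sumHalves n
  sumHalves-mono-≤ {m} m≤n with m≤n⇒∃[o]m+o≡n m≤n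
  ... | d , refl = ≤-trans (m≤m+n (sumHalves m) _) (≤-reflexive (sym (∑-split m d ⌊_/2⌋)))

  sumHalves+⌊n/2⌋≡⌊n/2⌋*⌈n/2⌉ : ∀ n → sumHalves n + ⌊ n /2⌋ ≡ ⌊ n /2⌋ * ⌈ n /2⌉
  sumHalves+⌊n/2⌋≡⌊n/2⌋*⌈n/2⌉ zero          = refl
  sumHalves+⌊n/2⌋≡⌊n/2⌋*⌈n/2⌉ (suc zero)    = refl
  sumHalves+⌊n/2⌋≡⌊n/2⌋*⌈n/2⌉ (suc (suc n)) = begin
    sumHalves n + f + c + suc f ≡⟨ cong (λ x → x + c + suc f) (sumHalves+⌊n/2⌋≡⌊n/2⌋*⌈n/2⌉ n) ⟩
    f * c + c + suc f           ≡⟨ expand f c ⟩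
    suc f * suc c               ∎
    where
    open ≡-Reasoning
    f = ⌊ n /2⌋
    c = ⌈ n /2⌉
    expand : ∀ f c → f * c + c + suc f ≡ suc f * suc c
    expand = solve-∀

  4*sumHalves+2*n≡n*n+n%2 : ∀ n → 4 * sumHalves n + 2 * n ≡ n * n + n % 2
  4*sumHalves+2*n≡n*n+n%2 zero          = refl
  4*sumHalves+2*n≡n*n+n%2 (suc zero)    = refl
  4*sumHalves+2*n≡n*n+n%2 (suc (suc n)) = begin
    4 * (sumHalves n + ⌊ n /2⌋ + ⌈ n /2⌉) + 2 * (2 + n)
      ≡⟨ regroup (sumHalves n) ⌊ n /2⌋ ⌈ n /2⌉ n ⟩
    (4 * sumHalves n + 2 * n) + 4 * (⌊ n /2⌋ + ⌈ n /2⌉) + 4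
      ≡⟨ cong₂ (λ x y → x + 4 * y + 4) (4*sumHalves+2*n≡n*n+n%2 n) (⌊n/2⌋+⌈n/2⌉≡n n) ⟩
    (n * n + n % 2) + 4 * n + 4
      ≡⟨ square (n % 2) n ⟩
    (2 + n) * (2 + n) + n % 2 ∎
    where
    open ≡-Reasoning
    regroup : ∀ h f c n → 4 * (h + f + c) + 2 * (2 + n) ≡ (4 * h + 2 * n) + 4 * (f + c) + 4
    regroup = solve-∀
    square : ∀ r n → (n * n + r) + 4 * n + 4 ≡ (2 + n) * (2 + n) + r
    square = solve-∀

  ⌊[m+m∸n]/2⌋≡m∸⌈n/2⌉ : ∀ m n → ⌊ (m + m ∸ n) /2⌋ ≡ m ∸ ⌈ n /2⌉
  ⌊[m+m∸n]/2⌋≡m∸⌈n/2⌉ zero    n             = trans (cong ⌊_/2⌋ (0∸n≡0 n)) (sym (0∸n≡0 ⌈ n /2⌉))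
  ⌊[m+m∸n]/2⌋≡m∸⌈n/2⌉ (suc m) zero          = sym (n≡⌊n+n/2⌋ (suc m))
  ⌊[m+m∸n]/2⌋≡m∸⌈n/2⌉ (suc m) (suc zero)    rewrite +-suc m m = sym (n≡⌈n+n/2⌉ m)
  ⌊[m+m∸n]/2⌋≡m∸⌈n/2⌉ (suc m) (suc (suc n)) rewrite +-suc m m = ⌊[m+m∸n]/2⌋≡m∸⌈n/2⌉ m n

  ⌈[m+m∸n]/2⌉≡m∸⌊n/2⌋ : ∀ m n → ⌈ (m + m ∸ n) /2⌉ ≡ m ∸ ⌊ n /2⌋
  ⌈[m+m∸n]/2⌉≡m∸⌊n/2⌋ zero    n             = trans (cong ⌈_/2⌉ (0∸n≡0 n)) (sym (0∸n≡0 ⌊ n /2⌋))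
  ⌈[m+m∸n]/2⌉≡m∸⌊n/2⌋ (suc m) zero          = sym (n≡⌈n+n/2⌉ (suc m))
  ⌈[m+m∸n]/2⌉≡m∸⌊n/2⌋ (suc m) (suc zero)    rewrite +-suc m m = cong suc (sym (n≡⌊n+n/2⌋ m))
  ⌈[m+m∸n]/2⌉≡m∸⌊n/2⌋ (suc m) (suc (suc n)) rewrite +-suc m m = ⌈[m+m∸n]/2⌉≡m∸⌊n/2⌋ m n

module SchurCounting where

  open import Data.Bool using (Bool; true; false; _∧_)
  open import Data.Bool.Properties using (∧-zeroʳ; ∧-identityʳ)
  open import Data.Fin using (Fin; zero; suc; toℕ)
  open import Data.Fin.Subset using (Subset; ⊤; ∣_∣)
  open import Data.Fin.Subset.Properties using (_∈?_; ∣p∣≤n)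
  open import Data.List using (map; allFin; cartesianProduct)
  open import Data.Nat.ListAction using (sum)
  open import Data.Nat
  open import Data.Nat.Properties
  open import Data.Nat.Tactic.RingSolver using (solve-∀)
  open import Data.Product using (_,_)
  open import Data.Vec using ([]; _∷_)
  open import Function using (_∘_)
  open import Relation.Binary.PropositionalEquality
  open import Relation.Nullary using (does)
  open import Relation.Nullary.Decidable using (dec-true; dec-false)
  open FiniteSums
  open HalfSums

  memberℕ : ∀ {n} → Subset n → ℕ → Bool
  memberℕ []      _       = false
  memberℕ (x ∷ _) zero    = x
  memberℕ (_ ∷ p) (suc i) = memberℕ p i

  does-∈?≡memberℕ : ∀ {n} (i : Fin n) (p : Subset n) → does (i ∈? p) ≡ memberℕ p (toℕ i)
  does-∈?≡memberℕ zero    (true  ∷ p) = refl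
  does-∈?≡memberℕ zero    (false ∷ p) = refl
  does-∈?≡memberℕ (suc i) (_ ∷ p)     = does-∈?≡memberℕ i p

  memberℕ-⊤ : ∀ {n i} → i < n → memberℕ (⊤ {n}) i ≡ true
  memberℕ-⊤ {suc n} {zero}  _        = refl
  memberℕ-⊤ {suc n} {suc i} (s≤s i<n) = memberℕ-⊤ i<n

  memberCount : (ℕ → Bool) → ℕ → ℕ
  memberCount P n = ∑[ i < n ] 𝟙 (P i)

  ∣p∣≡memberCount : ∀ {n} (p : Subset n) → ∣ p ∣ ≡ memberCount (memberℕ p) n
  ∣p∣≡memberCount {suc n} (true  ∷ p) = trans (cong suc (∣p∣≡memberCount p)) (sym (∑-head n _))
  ∣p∣≡memberCount {suc n} (false ∷ p) = trans (∣p∣≡memberCount p) (sym (∑-head n _))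
  ∣p∣≡memberCount []                  = refl

  -- As in Defs, index i stands for the integer i + 1: pairTerm P k i detects the pair of
  -- indices i < k ∸ suc i, i.e. integers a < b with a + b = k + 1, the first two entries of a
  -- Schur triple ending at index k.
  pairTerm : (ℕ → Bool) → ℕ → ℕ → ℕ
  pairTerm P k i = 𝟙 (P i ∧ P (k ∸ suc i) ∧ (i <ᵇ k ∸ suc i))

  pairCount : (ℕ → Bool) → ℕ → ℕ
  pairCount P k = ∑< k (pairTerm P k)

  schurCount : (ℕ → Bool) → ℕ → ℕ
  schurCount P n = ∑[ k < n ] (𝟙 (P k) * pairCount P k)

  𝟙+𝟙≤1+𝟙∧ : ∀ a b → 𝟙 a + 𝟙 b ≤ 1 + 𝟙 (a ∧ b)
  𝟙+𝟙≤1+𝟙∧ true  b = ≤-refl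
  𝟙+𝟙≤1+𝟙∧ false b = 𝟙≤1 b

  pairTerm-shift : ∀ P w i → i < w → pairTerm (P ∘ suc) w i ≡ pairTerm P (2 + w) (suc i)
  pairTerm-shift P w i i<w rewrite +-∸-assoc 1 i<w = refl

  memberCount≤⌈n/2⌉+pairCount : ∀ P w → memberCount P w ≤ ⌈ w /2⌉ + pairCount P w
  memberCount≤⌈n/2⌉+pairCount P zero          = z≤n
  memberCount≤⌈n/2⌉+pairCount P (suc zero)    = ≤-trans (𝟙≤1 (P 0)) (m≤m+n 1 _)
  memberCount≤⌈n/2⌉+pairCount P (suc (suc w)) = begin
    memberCount P (2 + w)
      ≡⟨ cong (_+ 𝟙 (P (suc w))) (∑-head w (𝟙 ∘ P)) ⟩
    𝟙 (P 0) + memberCount (P ∘ suc) w + 𝟙 (P (suc w))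
      ≤⟨ ends+middle (𝟙 (P 0)) ⌈ w /2⌉ (𝟙+𝟙≤1+𝟙∧ (P 0) (P (suc w))) (memberCount≤⌈n/2⌉+pairCount (P ∘ suc) w) ⟩
    suc ⌈ w /2⌉ + (𝟙 (P 0 ∧ P (suc w)) + pairCount (P ∘ suc) w)
      ≡⟨ cong (λ x → suc ⌈ w /2⌉ + (𝟙 x + pairCount (P ∘ suc) w)) (cong (P 0 ∧_) (sym (∧-identityʳ (P (suc w))))) ⟩
    suc ⌈ w /2⌉ + (pairTerm P (2 + w) 0 + pairCount (P ∘ suc) w)
      ≡⟨ cong (λ x → suc ⌈ w /2⌉ + (pairTerm P (2 + w) 0 + x)) (∑-cong w (pairTerm-shift P w)) ⟩
    suc ⌈ w /2⌉ + (pairTerm P (2 + w) 0 + ∑[ i < w ] pairTerm P (2 + w) (suc i))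
      ≡⟨ cong (suc ⌈ w /2⌉ +_) (sym (∑-head w (pairTerm P (2 + w)))) ⟩
    suc ⌈ w /2⌉ + ∑< (suc w) (pairTerm P (2 + w))
      ≤⟨ +-monoʳ-≤ (suc ⌈ w /2⌉) (m≤m+n _ _) ⟩
    ⌈ 2 + w /2⌉ + pairCount P (2 + w) ∎
    where
    open ≤-Reasoning
    ends+middle : ∀ a p {b c e q} → a + b ≤ 1 + e → c ≤ p + q → a + c + b ≤ suc p + (e + q)
    ends+middle a p {b} {c} {e} {q} ab≤ c≤ = begin
      a + c + b       ≡⟨ regroup a b c ⟩
      (a + b) + c     ≤⟨ +-mono-≤ ab≤ c≤ ⟩
      (1 + e) + (p + q) ≡⟨ regroup′ e p q ⟩
      suc p + (e + q) ∎
      where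
      regroup : ∀ a b c → a + c + b ≡ (a + b) + c
      regroup = solve-∀
      regroup′ : ∀ e p q → (1 + e) + (p + q) ≡ suc p + (e + q)
      regroup′ = solve-∀

  schurIndicator : (ℕ → Bool) → ℕ → ℕ → ℕ → ℕ
  schurIndicator P i j k = 𝟙 (P i ∧ P j ∧ P k ∧ does (suc i <? suc j) ∧ does (suc i + suc j ≟ suc k))

  𝟙-isSchurTripleIn? : ∀ {n} (A : Subset n) a b c →
    𝟙 (does (isSchurTripleIn? A (a , b , c))) ≡ schurIndicator (memberℕ A) (toℕ a) (toℕ b) (toℕ c)
  𝟙-isSchurTripleIn? A a b c
    rewrite does-∈?≡memberℕ a A | does-∈?≡memberℕ b A | does-∈?≡memberℕ c A = refl

  s≡∑∑∑schurIndicator : ∀ {n} (A : Subset n) →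
    s A ≡ ∑[ i < n ] ∑[ j < n ] ∑[ k < n ] schurIndicator (memberℕ A) i j k
  s≡∑∑∑schurIndicator {n} A = begin
    s A
      ≡⟨ length-filter (isSchurTripleIn? A) (allTriples n) ⟩
    sum (map 𝟙? (cartesianProduct (allFin n) (cartesianProduct (allFin n) (allFin n))))
      ≡⟨ sum-cartesianProduct 𝟙? (allFin n) _ ⟩
    sum (map (λ a → sum (map (λ bc → 𝟙? (a , bc)) (cartesianProduct (allFin n) (allFin n)))) (allFin n))
      ≡⟨ sum-allFin _ _ (λ a → trans (sum-cartesianProduct _ (allFin n) (allFin n))
           (sum-allFin _ _ λ b → sum-allFin _ _ λ c → 𝟙-isSchurTripleIn? A a b c)) ⟩
    ∑[ i < n ] ∑[ j < n ] ∑[ k < n ] schurIndicator (memberℕ A) i j k ∎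
    where
    open ≡-Reasoning
    𝟙? = 𝟙 ∘ does ∘ isSchurTripleIn? A

  𝟙[a∧b∧c∧d]≡𝟙c*𝟙[a∧b∧d] : ∀ a b c d → 𝟙 (a ∧ b ∧ c ∧ d) ≡ 𝟙 c * 𝟙 (a ∧ b ∧ d)
  𝟙[a∧b∧c∧d]≡𝟙c*𝟙[a∧b∧d] false b     c     d = sym (*-zeroʳ (𝟙 c))
  𝟙[a∧b∧c∧d]≡𝟙c*𝟙[a∧b∧d] true  false c     d = sym (*-zeroʳ (𝟙 c))
  𝟙[a∧b∧c∧d]≡𝟙c*𝟙[a∧b∧d] true  true  false d = refl
  𝟙[a∧b∧c∧d]≡𝟙c*𝟙[a∧b∧d] true  true  true  d = sym (+-identityʳ (𝟙 d))

  schurIndicator-≢ : ∀ P {i j k} → suc i + suc j ≢ suc k → schurIndicator P i j k ≡ 0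
  schurIndicator-≢ P {i} {j} {k} i+j≢k
    rewrite dec-false (suc i + suc j ≟ suc k) i+j≢k
          | ∧-zeroʳ (does (suc i <? suc j)) | ∧-zeroʳ (P k) | ∧-zeroʳ (P j) | ∧-zeroʳ (P i) = refl

  schurIndicator-≡ : ∀ P {i j k} → suc i + suc j ≡ suc k →
    schurIndicator P i j k ≡ 𝟙 (P k) * 𝟙 (P i ∧ P j ∧ (i <ᵇ j))
  schurIndicator-≡ P {i} {j} {k} i+j≡k
    rewrite dec-true (suc i + suc j ≟ suc k) i+j≡k | ∧-identityʳ (does (suc i <? suc j))
    = 𝟙[a∧b∧c∧d]≡𝟙c*𝟙[a∧b∧d] (P i) (P j) (P k) (i <ᵇ j)

  ∑schurIndicator-< : ∀ P {n i k} → i < k → k < n →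
    ∑[ j < n ] schurIndicator P i j k ≡ 𝟙 (P k) * pairTerm P k i
  ∑schurIndicator-< P {n} {i} {k} i<k k<n =
    trans (∑-single n (k ∸ suc i) (≤-<-trans (m∸n≤m k (suc i)) k<n)
                    λ j _ j≢k∸1+i → schurIndicator-≢ P (j≢k∸1+i ∘ solve-for j))
          (schurIndicator-≡ P (cong suc (trans (+-suc i _) (m+[n∸m]≡n i<k))))
    where
    solve-for : ∀ j → suc i + suc j ≡ suc k → j ≡ k ∸ suc i
    solve-for j i+j≡k = trans (sym (m+n∸m≡n (suc i) j))
                              (cong (_∸ suc i) (trans (sym (+-suc i j)) (suc-injective i+j≡k)))

  ∑schurIndicator-≥ : ∀ P {n i k} → k ≤ i → ∑[ j < n ] schurIndicator P i j k ≡ 0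
  ∑schurIndicator-≥ P {n} {i} k≤i = ∑-zero n λ j _ → schurIndicator-≢ P λ i+j≡k →
    m+1+n≰m (suc i) (≤-trans (≤-reflexive i+j≡k) (s≤s k≤i))

  ∑∑schurIndicator : ∀ P {n k} → k < n →
    ∑[ i < n ] ∑[ j < n ] schurIndicator P i j k ≡ 𝟙 (P k) * pairCount P k
  ∑∑schurIndicator P {n} {k} k<n = begin
    ∑< n f
      ≡⟨ cong (λ m → ∑< m f) (sym (m+[n∸m]≡n (<⇒≤ k<n))) ⟩
    ∑< (k + (n ∸ k)) f
      ≡⟨ ∑-split k (n ∸ k) f ⟩
    ∑< k f + ∑[ d < n ∸ k ] f (k + d)
      ≡⟨ cong₂ _+_ (∑-cong k λ i i<k → ∑schurIndicator-< P i<k k<n)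
                   (∑-zero (n ∸ k) λ d _ → ∑schurIndicator-≥ P {n} (m≤m+n k d)) ⟩
    ∑[ i < k ] (𝟙 (P k) * pairTerm P k i) + 0
      ≡⟨ +-identityʳ _ ⟩
    ∑[ i < k ] (𝟙 (P k) * pairTerm P k i)
      ≡⟨ ∑-*ˡ k (𝟙 (P k)) (pairTerm P k) ⟩
    𝟙 (P k) * pairCount P k ∎
    where
    open ≡-Reasoning
    f = λ i → ∑[ j < n ] schurIndicator P i j k

  s≡schurCount : ∀ {n} (A : Subset n) → s A ≡ schurCount (memberℕ A) n
  s≡schurCount {n} A = begin
    s A
      ≡⟨ s≡∑∑∑schurIndicator A ⟩
    ∑[ i < n ] ∑[ j < n ] ∑[ k < n ] schurIndicator P i j k
      ≡⟨ ∑-cong n (λ i _ → ∑-swap n n (schurIndicator P i)) ⟩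
    ∑[ i < n ] ∑[ k < n ] ∑[ j < n ] schurIndicator P i j k
      ≡⟨ ∑-swap n n _ ⟩
    ∑[ k < n ] ∑[ i < n ] ∑[ j < n ] schurIndicator P i j k
      ≡⟨ ∑-cong n (λ _ → ∑∑schurIndicator P) ⟩
    schurCount P n ∎
    where
    open ≡-Reasoning
    P = memberℕ A

  excess-step : ∀ c N → c + 1 + (c + 1) ∸ suc N ≤ suc (c + c ∸ N)
  excess-step c N rewrite +-comm c 1 | +-suc c c =
    m≤n+o⇒m∸n≤o (suc (c + c)) N (≤-trans (s≤s (m≤n+m∸n (c + c) N)) (≤-reflexive (sym (+-suc N _))))

  sumHalves-excess≤schurCount : ∀ P N → sumHalves (memberCount P N + memberCount P N ∸ N) ≤ schurCount P N
  sumHalves-excess≤schurCount P zero    = z≤n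
  sumHalves-excess≤schurCount P (suc N) with P N
  ... | false = begin
    sumHalves (c + 0 + (c + 0) ∸ suc N) ≡⟨ cong (λ x → sumHalves (x + x ∸ suc N)) (+-identityʳ c) ⟩
    sumHalves (c + c ∸ suc N)           ≤⟨ sumHalves-mono-≤ (∸-monoʳ-≤ (c + c) (n≤1+n N)) ⟩
    sumHalves (c + c ∸ N)               ≤⟨ sumHalves-excess≤schurCount P N ⟩
    schurCount P N                      ≡⟨ sym (+-identityʳ _) ⟩
    schurCount P N + 0                  ∎
    where
    open ≤-Reasoning
    c = memberCount P N
  ... | true = begin
    sumHalves (c + 1 + (c + 1) ∸ suc N)       ≤⟨ sumHalves-mono-≤ (excess-step c N) ⟩
    sumHalves (c + c ∸ N) + ⌊ (c + c ∸ N) /2⌋ ≤⟨ +-mono-≤ (sumHalves-excess≤schurCount P N) new-triples ⟩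
    schurCount P N + pairCount P N            ≡⟨ cong (schurCount P N +_) (sym (+-identityʳ _)) ⟩
    schurCount P N + 1 * pairCount P N        ∎
    where
    open ≤-Reasoning
    c = memberCount P N
    new-triples : ⌊ (c + c ∸ N) /2⌋ ≤ pairCount P N
    new-triples = ≤-trans (≤-reflexive (⌊[m+m∸n]/2⌋≡m∸⌈n/2⌉ c N))
                          (m≤n+o⇒m∸n≤o c ⌈ N /2⌉ (memberCount≤⌈n/2⌉+pairCount P N))

  sumHalves-excess≤s : ∀ {n} (A : Subset n) → sumHalves (∣ A ∣ + ∣ A ∣ ∸ n) ≤ s A
  sumHalves-excess≤s {n} A = subst₂ (λ c t → sumHalves (c + c ∸ n) ≤ t)
    (sym (∣p∣≡memberCount A)) (sym (s≡schurCount A)) (sumHalves-excess≤schurCount (memberℕ A) n)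

  ∑𝟙[i<k∸1+i]≡⌊k/2⌋ : ∀ k → ∑[ i < k ] 𝟙 (i <ᵇ k ∸ suc i) ≡ ⌊ k /2⌋
  ∑𝟙[i<k∸1+i]≡⌊k/2⌋ zero          = refl
  ∑𝟙[i<k∸1+i]≡⌊k/2⌋ (suc zero)    = refl
  ∑𝟙[i<k∸1+i]≡⌊k/2⌋ (suc (suc k)) = begin
    ∑< (suc k) f + f (suc k)    ≡⟨ cong (λ m → ∑< (suc k) f + 𝟙 (suc k <ᵇ m)) (n∸n≡0 k) ⟩
    ∑< (suc k) f + 0            ≡⟨ +-identityʳ _ ⟩
    ∑< (suc k) f                ≡⟨ ∑-head k f ⟩
    1 + ∑[ i < k ] f (suc i)    ≡⟨ cong suc (∑-cong k λ i i<k → cong (λ m → 𝟙 (suc i <ᵇ m)) (+-∸-assoc 1 i<k)) ⟩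
    1 + ∑[ i < k ] 𝟙 (i <ᵇ k ∸ suc i) ≡⟨ cong suc (∑𝟙[i<k∸1+i]≡⌊k/2⌋ k) ⟩
    1 + ⌊ k /2⌋                 ∎
    where
    open ≡-Reasoning
    f = λ i → 𝟙 (i <ᵇ suc (suc k) ∸ suc i)

  s⊤≡sumHalves : ∀ n → s (⊤ {n}) ≡ sumHalves n
  s⊤≡sumHalves n = trans (s≡schurCount (⊤ {n})) (∑-cong n λ k k<n → begin
    𝟙 (P k) * pairCount P k  ≡⟨ cong (λ b → 𝟙 b * pairCount P k) (memberℕ-⊤ k<n) ⟩
    pairCount P k + 0        ≡⟨ +-identityʳ _ ⟩
    pairCount P k            ≡⟨ ∑-cong k (λ i i<k → cong 𝟙 (everyPair k<n i<k)) ⟩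
    ∑[ i < k ] 𝟙 (i <ᵇ k ∸ suc i) ≡⟨ ∑𝟙[i<k∸1+i]≡⌊k/2⌋ k ⟩
    ⌊ k /2⌋                  ∎)
    where
    open ≡-Reasoning
    P = memberℕ (⊤ {n})
    everyPair : ∀ {k i} → k < n → i < k → P i ∧ P (k ∸ suc i) ∧ (i <ᵇ k ∸ suc i) ≡ (i <ᵇ k ∸ suc i)
    everyPair {k} {i} k<n i<k
      rewrite memberℕ-⊤ {n} (<-trans i<k k<n) | memberℕ-⊤ {n} (≤-<-trans (m∸n≤m k (suc i)) k<n) = refl

  m∸n+m∸n≤m : ∀ {m n} → n ≤ m → m ≤ n + n → (m ∸ n) + (m ∸ n) ≤ m
  m∸n+m∸n≤m {m} {n} n≤m m≤2n =
    ≤-trans (+-monoʳ-≤ (m ∸ n) (m≤n+o⇒m∸n≤o m n m≤2n)) (≤-reflexive (m∸n+n≡m n≤m))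

  s-lowerBound-doubled : ∀ {n} (A : Subset n) → ⌈ n /2⌉ ≤ ∣ A ∣ →
    (∣ A ∣ ∸ ⌈ n /2⌉) * (∣ A ∣ ∸ ⌊ n /2⌋) + (∣ A ∣ ∸ ⌈ n /2⌉) * (∣ A ∣ ∸ ⌊ n /2⌋) ≤ s A + s A + ∣ A ∣
  s-lowerBound-doubled {n} A ⌈n/2⌉≤c = begin
    u * v + u * v             ≤⟨ +-mono-≤ bound bound ⟩
    (s A + u) + (s A + u)     ≡⟨ regroup (s A) u ⟩
    s A + s A + (u + u)       ≤⟨ +-monoʳ-≤ (s A + s A) (m∸n+m∸n≤m ⌈n/2⌉≤c c≤2⌈n/2⌉) ⟩
    s A + s A + c             ∎
    where
    open ≤-Reasoning
    c = ∣ A ∣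
    u = c ∸ ⌈ n /2⌉
    v = c ∸ ⌊ n /2⌋
    m = c + c ∸ n
    bound : u * v ≤ s A + u
    bound = begin
      u * v                 ≡⟨ sym (cong₂ _*_ (⌊[m+m∸n]/2⌋≡m∸⌈n/2⌉ c n) (⌈[m+m∸n]/2⌉≡m∸⌊n/2⌋ c n)) ⟩
      ⌊ m /2⌋ * ⌈ m /2⌉     ≡⟨ sym (sumHalves+⌊n/2⌋≡⌊n/2⌋*⌈n/2⌉ m) ⟩
      sumHalves m + ⌊ m /2⌋ ≤⟨ +-mono-≤ (sumHalves-excess≤s A) (≤-reflexive (⌊[m+m∸n]/2⌋≡m∸⌈n/2⌉ c n)) ⟩
      s A + u               ∎
    c≤2⌈n/2⌉ : c ≤ ⌈ n /2⌉ + ⌈ n /2⌉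
    c≤2⌈n/2⌉ = ≤-trans (∣p∣≤n A) (≤-trans (≤-reflexive (sym (⌊n/2⌋+⌈n/2⌉≡n n)))
                                          (+-monoˡ-≤ ⌈ n /2⌉ (⌊n/2⌋≤⌈n/2⌉ n)))
    regroup : ∀ t u → (t + u) + (t + u) ≡ t + t + (u + u)
    regroup = solve-∀

open import Data.Nat using (ℕ; _*_; _<_; _%_; ⌈_/2⌉; ⌊_/2⌋)
open import Data.Integer using (+_; _-_)
open import Data.Rational using (ℚ; _≤_; _/_)
open import Data.Fin.Subset using (Subset; ⊤; ∣_∣)
open import Data.Product using (_×_)
open import Relation.Binary.PropositionalEquality using (_≡_)

import Data.Integer as ℤ
import Data.Integer.Properties as ℤ
open import Data.Integer.Tactic.RingSolver using (solve-∀)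
import Data.Nat as ℕ
import Data.Nat.Properties as ℕ
import Data.Rational as ℚ
import Data.Rational.Properties as ℚ
import Data.Rational.Unnormalised as ℚᵘ
import Data.Rational.Unnormalised.Properties as ℚᵘ
open import Data.Product using (_,_)
open import Relation.Binary.PropositionalEquality using (refl; sym; trans; cong; cong₂; subst; module ≡-Reasoning)
open HalfSums using (sumHalves; 4*sumHalves+2*n≡n*n+n%2)
open SchurCounting using (s⊤≡sumHalves; s-lowerBound-doubled)

+m-+n≡+[m∸n] : ∀ {m n} → n ℕ.≤ m → + m - + n ≡ + (m ℕ.∸ n)
+m-+n≡+[m∸n] {m} {n} n≤m = trans (ℤ.[+m]-[+n]≡m⊖n m n) (ℤ.⊖-≥ n≤m)

[a]-[m]/2≤[b] : ∀ a m b → a ℕ.+ a ℕ.≤ b ℕ.+ b ℕ.+ m → (+ a) / 1 ℚ.- (+ m) / 2 ≤ (+ b) / 1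
[a]-[m]/2≤[b] a m b 2a≤2b+m = ℚ.toℚᵘ-cancel-≤
  (ℚᵘ.≤-respʳ-≃ (ℚᵘ.≃-sym (ℚ.toℚᵘ-fromℚᵘ ((+ b) ℚᵘ./ 1)))
    (ℚᵘ.≤-respˡ-≃ (ℚᵘ.≃-sym toℚᵘ-lhs) (ℚᵘ.*≤* cross-multiplied)))
  where
  toℚᵘ-lhs : ℚ.toℚᵘ ((+ a) / 1 ℚ.- (+ m) / 2) ℚᵘ.≃ (+ a) ℚᵘ./ 1 ℚᵘ.- (+ m) ℚᵘ./ 2
  toℚᵘ-lhs = ℚᵘ.≃-trans (ℚ.toℚᵘ-homo-+ ((+ a) / 1) (ℚ.- ((+ m) / 2)))
    (ℚᵘ.+-cong (ℚ.toℚᵘ-fromℚᵘ ((+ a) ℚᵘ./ 1))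
               (ℚᵘ.≃-trans (ℚ.toℚᵘ-homo‿- ((+ m) / 2)) (ℚᵘ.-‿cong (ℚ.toℚᵘ-fromℚᵘ ((+ m) ℚᵘ./ 2)))))
  cross-multiplied : (+ a ℤ.* + 2 ℤ.+ ℤ.- + m ℤ.* + 1) ℤ.* + 1 ℤ.≤ + b ℤ.* + 2
  cross-multiplied = begin
    (+ a ℤ.* + 2 ℤ.+ ℤ.- + m ℤ.* + 1) ℤ.* + 1 ≡⟨ lhs-form (+ a) (+ m) ⟩
    + (a ℕ.+ a) - + m                         ≤⟨ ℤ.+-monoˡ-≤ (ℤ.- + m) (ℤ.+≤+ 2a≤2b+m) ⟩
    + (b ℕ.+ b ℕ.+ m) - + m                   ≡⟨ rhs-form (+ b) (+ m) ⟩
    + b ℤ.* + 2                               ∎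
    where
    open ℤ.≤-Reasoning
    lhs-form : ∀ x y → (x ℤ.* + 2 ℤ.+ ℤ.- y ℤ.* + 1) ℤ.* + 1 ≡ x ℤ.+ x - y
    lhs-form = solve-∀
    rhs-form : ∀ x y → x ℤ.+ x ℤ.+ y - y ≡ x ℤ.* + 2
    rhs-form = solve-∀

[x]/1≡z/4 : ∀ x z → z ≡ + (4 ℕ.* x) → (+ x) / 1 ≡ z / 4
[x]/1≡z/4 x z z≡4x = ℚ.fromℚᵘ-cong {(+ x) ℚᵘ./ 1} {z ℚᵘ./ 4} (ℚᵘ.*≡* (begin
  + x ℤ.* + 4 ≡⟨ ℤ.*-comm (+ x) (+ 4) ⟩
  + 4 ℤ.* + x ≡⟨ sym (ℤ.pos-* 4 x) ⟩
  + (4 ℕ.* x) ≡⟨ sym z≡4x ⟩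
  z           ≡⟨ sym (ℤ.*-identityʳ z) ⟩
  z ℤ.* + 1   ∎))
  where open ≡-Reasoning

s⊤≡[n*n-2n+n%2]/4 : ∀ n → (+ s (⊤ {n})) / 1 ≡ (+ (n * n) - + (2 * n) ℤ.+ + (n % 2)) / 4
s⊤≡[n*n-2n+n%2]/4 n rewrite s⊤≡sumHalves n = [x]/1≡z/4 (sumHalves n) _ (begin
  + (n * n) - + (2 * n) ℤ.+ + (n % 2) ≡⟨ swap (+ (n * n)) (+ (2 * n)) (+ (n % 2)) ⟩
  + (n * n ℕ.+ n % 2) - + (2 * n)     ≡⟨ cong (λ k → + k - + (2 * n)) (sym (4*sumHalves+2*n≡n*n+n%2 n)) ⟩
  + (4 * sumHalves n ℕ.+ 2 * n) - + (2 * n) ≡⟨ cancel (+ (4 * sumHalves n)) (+ (2 * n)) ⟩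
  + (4 * sumHalves n)                 ∎)
  where
  open ≡-Reasoning
  swap : ∀ x y r → x - y ℤ.+ r ≡ x ℤ.+ r - y
  swap = solve-∀
  cancel : ∀ x y → x ℤ.+ y - y ≡ x
  cancel = solve-∀

schur-lower-bound : (n : ℕ) (A : Subset n) → ⌈ n /2⌉ < ∣ A ∣ →
  ((+ ∣ A ∣ - + ⌈ n /2⌉) ℤ.* (+ ∣ A ∣ - + ⌊ n /2⌋)) / 1 ℚ.- (+ ∣ A ∣) / 2 ≤ (+ s A) / 1
schur-lower-bound n A ⌈n/2⌉<c = subst (λ z → z / 1 ℚ.- (+ c) / 2 ≤ (+ s A) / 1) (sym product)
  ([a]-[m]/2≤[b] a c (s A) (s-lowerBound-doubled A ⌈n/2⌉≤c))
  where
  c = ∣ A ∣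
  a = (c ℕ.∸ ⌈ n /2⌉) * (c ℕ.∸ ⌊ n /2⌋)
  ⌈n/2⌉≤c = ℕ.<⇒≤ ⌈n/2⌉<c
  product : (+ c - + ⌈ n /2⌉) ℤ.* (+ c - + ⌊ n /2⌋) ≡ + a
  product = trans (cong₂ ℤ._*_ (+m-+n≡+[m∸n] ⌈n/2⌉≤c) (+m-+n≡+[m∸n] (ℕ.≤-trans (ℕ.⌊n/2⌋≤⌈n/2⌉ n) ⌈n/2⌉≤c)))
                  (sym (ℤ.pos-* (c ℕ.∸ ⌈ n /2⌉) (c ℕ.∸ ⌊ n /2⌋)))

s⊤-even : (n : ℕ) → n % 2 ≡ 0 → (+ s (⊤ {n})) / 1 ≡ (+ (n * n) - + (2 * n)) / 4
s⊤-even n even rewrite s⊤≡[n*n-2n+n%2]/4 n | even = cong (_/ 4) (ℤ.+-identityʳ (+ (n * n) - + (2 * n)))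

s⊤-odd : (n : ℕ) → n % 2 ≡ 1 → (+ s (⊤ {n})) / 1 ≡ (+ (n * n) - + (2 * n) ℤ.+ + 1) / 4
s⊤-odd n odd rewrite s⊤≡[n*n-2n+n%2]/4 n | odd = refl

mainTheorem6 :
    ((n : ℕ) (A : Subset n) → ⌈ n /2⌉ < ∣ A ∣ →
      ((+ ∣ A ∣ - + ⌈ n /2⌉) Data.Integer.* (+ ∣ A ∣ - + ⌊ n /2⌋)) / 1 Data.Rational.- (+ ∣ A ∣) / 2
        ≤ (+ s A) / 1)
    × ((n : ℕ) → n % 2 ≡ 0 → (+ s (⊤ {n})) / 1 ≡ (+ (n * n) - + (2 * n)) / 4)
    × ((n : ℕ) → n % 2 ≡ 1 → (+ s (⊤ {n})) / 1 ≡ (+ (n * n) - + (2 * n) Data.Integer.+ + 1) / 4)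
mainTheorem6 = schur-lower-bound , s⊤-even , s⊤-odd
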